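{- Let $X$ be a non-empty set of positive integers with $X\neq\{1\}$ and let $\ell$ be a positive integer. The graph $B(X)$ contains a subgraph isomorphic to $\mathtt{Inc}(K_\ell)$ if and only if one of the following holds: (i) $\Gamma(X)$ contains a complete subgraph $K_\ell$ with vertices $x_1,\dots,x_\ell$, and there are $\binom{\ell}{2}$ pairwise distinct primes $p_{ij}$, $1\le i<j\le\ell$, such that $p_{ij}$ divides $\gcd(x_i,x_j)$; (ii) $\Delta(X)$ contains a complete subgraph $K_\ell$ with vertices $p_1,\dots,p_\ell$, and there are $\binom{\ell}{2}$ pairwise distinct numbers $x_{ij}\in X^*$, $1\le i<j\le\ell$, such that $p_ip_j$ divides $x_{ij}$.
   Context: For a non-empty set $X$ of positive integers, $\rho(X)$ is the set of primes dividing some element of $X$ and $X^*=X\setminus\{1\}$. $B(X)$ is the bipartite graph with vertex set the disjoint union $\rho(X)\cup X^*$ and edges $\{p,x\}$ for $p\in\rho(X)$, $x\in X^*$, $p\mid x$. $\Delta(X)$ has vertex set $\rho(X)$, distinct $p,q$ adjacent iff $pq$ divides some element of $X$. $\Gamma(X)$ has vertex set $X^*$, distinct $x,y$ adjacent iff $\gcd(x,y)>1$. A subgraph of a graph $(V,E)$ is a graph $(V_0,E_0)$ with $V_0\subseteq V$ and $E_0\subseteq E$ consisting of pairs from $V_0$ (not necessarily induced). For a graph $\mathcal{G}=(V,E)$, the incidence graph $\mathtt{Inc}(\mathcal{G})$ is the bipartite graph with vertex set $V\dot\cup E$ in which $\{v,e\}$ is an edge iff $v\in V$, $e\in E$ and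 $v$ is incident with $e$. $K_\ell$ is the complete graph on $\ell$ vertices. -}

module Defs where

open import Level using (0ℓ)
open import Data.Nat using (ℕ; _<_; _≤_; _*_)
open import Data.Nat.Divisibility using (_∣_)
open import Data.Nat.GCD using (gcd)
open import Data.Nat.Primality using (Prime)
open import Data.Fin as Fin using (Fin)
open import Data.Sum using (_⊎_; inj₁; inj₂)
open import Data.Product using (Σ; ∃; ∃-syntax; _×_; _,_)
open import Data.Unit using (⊤)
open import Data.Empty using (⊥)
open import Relation.Nullary using (¬_)
open import Relation.Binary.PropositionalEquality using (_≡_; _≢_)
open import Function.Bundles using (_⇔_)

NatSet : Set₁
NatSet = ℕ → Set

record Graph : Set₁ where
  field
    V    : Set
    Vert : V → Set
    Adj  : V → V → Set
open Graph public

-- G contains a (not necessarily induced) subgraph isomorphic to H: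
-- an injective map on vertices sending vertices to vertices and edges to edges.
ContainsCopyOf : Graph → Graph → Set
ContainsCopyOf G H =
  Σ (V H → V G) λ f →
      (∀ u → Vert H u → Vert G (f u))
    × (∀ u v → Vert H u → Vert H v → f u ≡ f v → u ≡ v)
    × (∀ u v → Vert H u → Vert H v → Adj H u v → Adj G (f u) (f v))

Inρ : NatSet → ℕ → Set
Inρ X p = Prime p × ∃[ x ] (X x × p ∣ x)

InX* : NatSet → ℕ → Set
InX* X x = X x × x ≢ 1

-- B(X): vertices inj₁ p (p ∈ ρ(X)) and inj₂ x (x ∈ X*), edges {p,x} with p ∣ x.
BAdj : ℕ ⊎ ℕ → ℕ ⊎ ℕ → Set
BAdj (inj₁ p) (inj₂ x) = p ∣ x
BAdj (inj₂ x) (inj₁ p) = p ∣ x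
BAdj _ _ = ⊥

BVert : NatSet → ℕ ⊎ ℕ → Set
BVert X (inj₁ p) = Inρ X p
BVert X (inj₂ x) = InX* X x

B : NatSet → Graph
B X = record { V = ℕ ⊎ ℕ ; Vert = BVert X ; Adj = BAdj }

ΔAdj : NatSet → ℕ → ℕ → Set
ΔAdj X p q = p ≢ q × ∃[ x ] (X x × p * q ∣ x)

ΓAdj : ℕ → ℕ → Set
ΓAdj x y = x ≢ y × 1 < gcd x y

-- Inc(K_ℓ): vertices inj₁ v (v ∈ Fin ℓ) and inj₂ (i , j) with i < j (the edge {i,j});
-- v is adjacent to the edge (i , j) iff v = i or v = j.
IncVert : (ℓ : ℕ) → Fin ℓ ⊎ (Fin ℓ × Fin ℓ) → Set
IncVert ℓ (inj₁ _) = ⊤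
IncVert ℓ (inj₂ (i , j)) = i Fin.< j

IncAdj : (ℓ : ℕ) → Fin ℓ ⊎ (Fin ℓ × Fin ℓ) → Fin ℓ ⊎ (Fin ℓ × Fin ℓ) → Set
IncAdj ℓ (inj₁ v) (inj₂ (i , j)) = v ≡ i ⊎ v ≡ j
IncAdj ℓ (inj₂ (i , j)) (inj₁ v) = v ≡ i ⊎ v ≡ j
IncAdj ℓ _ _ = ⊥

IncK : ℕ → Graph
IncK ℓ = record { V = Fin ℓ ⊎ (Fin ℓ × Fin ℓ) ; Vert = IncVert ℓ ; Adj = IncAdj ℓ }

PairInjective : {ℓ : ℕ} → ((i j : Fin ℓ) → i Fin.< j → ℕ) → Set
PairInjective {ℓ} q =
  ∀ (i j k l : Fin ℓ) (h : i Fin.< j) (h' : k Fin.< l) → q i j h ≡ q k l h' → (i ≡ k × j ≡ l)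

CondI : NatSet → ℕ → Set
CondI X ℓ =
  Σ (Fin ℓ → ℕ) λ x →
      (∀ i → InX* X (x i))
    × (∀ i j → x i ≡ x j → i ≡ j)
    × (∀ i j → i ≢ j → ΓAdj (x i) (x j))
    × Σ ((i j : Fin ℓ) → i Fin.< j → ℕ) λ p →
          PairInjective p
        × (∀ i j (h : i Fin.< j) → Prime (p i j h) × p i j h ∣ gcd (x i) (x j))

CondII : NatSet → ℕ → Set
CondII X ℓ =
  Σ (Fin ℓ → ℕ) λ p →
      (∀ i → Inρ X (p i))
    × (∀ i j → p i ≡ p j → i ≡ j)
    × (∀ i j → i ≢ j → ΔAdj X (p i) (p j))
    × Σ ((i j : Fin ℓ) → i Fin.< j → ℕ) λ x →
          PairInjective x
        × (∀ i j (h : i Fin.< j) → InX* X (x i j h) × p i * p j ∣ x i j h)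

-- B(X) is bipartite, with the primes on one side and the numbers of X* on the other.
-- Any two vertices of Inc(K_ℓ) have a common neighbour, so a copy of Inc(K_ℓ) puts all
-- ℓ vertices on one side of B(X) and all edges on the other.  With the vertices on the
-- number side, the edge {i,j} becomes a prime dividing x_i and x_j, i.e. gcd(x_i,x_j):
-- condition (i).  With the vertices on the prime side, it becomes an element of X*
-- divisible by the distinct primes p_i and p_j, hence by p_i p_j: condition (ii).
module Submission where

open import Defs
open import Data.Nat using (ℕ; _<_; _≤_; _*_; suc; z<s)
open import Data.Nat.Base using (nonTrivial⇒n>1; ≢-nonZero)
open import Data.Nat.Properties using (*-comm; <-≤-trans; >⇒≢)
open import Data.Nat.Divisibility using (_∣_; divides; ∣-trans; ∣⇒≤; m∣m*n; n∣m*n; *-monoʳ-∣)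
open import Data.Nat.GCD using (gcd; gcd[m,n]∣m; gcd[m,n]∣n; gcd-greatest; gcd-comm; gcd[m,n]≢0)
open import Data.Nat.Primality using (Prime; euclidsLemma; prime⇒irreducible; prime⇒nonTrivial)
open import Data.Fin as Fin using (Fin)
open import Data.Fin.Properties using (<-cmp; _<?_; <-irrelevant; <⇒≢)
open import Data.Sum using (_⊎_; inj₁; inj₂; reduce)
open import Data.Sum.Properties using (inj₁-injective; inj₂-injective)
open import Data.Product using (Σ; ∃-syntax; _×_; _,_; proj₁; proj₂)
open import Data.Product.Properties using (,-injectiveˡ; ,-injectiveʳ)
open import Data.Unit using (tt)
open import Data.Empty using (⊥-elim)
open import Relation.Nullary using (¬_; yes; no)
open import Relation.Binary using (Symmetric; tri<; tri≈; tri>)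
open import Relation.Binary.PropositionalEquality
  using (_≡_; _≢_; refl; sym; trans; cong; cong₂; subst; subst₂)
open import Function.Bundles using (_⇔_; mk⇔)

prime⇒1< : ∀ {p} → Prime p → 1 < p
prime⇒1< {p} pp = nonTrivial⇒n>1 p {{prime⇒nonTrivial pp}}

prime∣⇒1< : ∀ {p n} → n ≢ 0 → Prime p → p ∣ n → 1 < n
prime∣⇒1< n≢0 pp p∣n = <-≤-trans (prime⇒1< pp) (∣⇒≤ {{≢-nonZero n≢0}} p∣n)

distinct-primes⇒*∣ : ∀ {p q n} → Prime p → Prime q → p ≢ q → p ∣ n → q ∣ n → p * q ∣ n
distinct-primes⇒*∣ {p} {q} pp qp p≢q (divides k refl) q∣kp with euclidsLemma k p qp q∣kp
... | inj₁ q∣k = subst (p * q ∣_) (*-comm p k) (*-monoʳ-∣ p q∣k)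
... | inj₂ q∣p with prime⇒irreducible pp q∣p
...   | inj₁ q≡1 = ⊥-elim (>⇒≢ (prime⇒1< qp) q≡1)
...   | inj₂ q≡p = ⊥-elim (p≢q (sym q≡p))

ΔAdj-sym : ∀ X → Symmetric (ΔAdj X)
ΔAdj-sym X {p} {q} (p≢q , x , Xx , pq∣x) =
  (λ q≡p → p≢q (sym q≡p)) , x , Xx , subst (_∣ x) (*-comm p q) pq∣x

ΓAdj-sym : Symmetric ΓAdj
ΓAdj-sym {x} {y} (x≢y , 1<gcd) = (λ y≡x → x≢y (sym y≡x)) , subst (1 <_) (gcd-comm x y) 1<gcd

ordered⇒distinct : ∀ {ℓ} {R : Fin ℓ → Fin ℓ → Set} → Symmetric R →
                   (∀ i j → i Fin.< j → R i j) → ∀ i j → i ≢ j → R i j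
ordered⇒distinct sym-R R< i j i≢j with <-cmp i j
... | tri< i<j _ _ = R< i j i<j
... | tri≈ _ i≡j _ = ⊥-elim (i≢j i≡j)
... | tri> _ _ j<i = sym-R (R< j i j<i)

data Side : Set where
  primes numbers : Side

opp : Side → Side
opp primes  = numbers
opp numbers = primes

embed : Side → ℕ → ℕ ⊎ ℕ
embed primes  = inj₁
embed numbers = inj₂

OnSide : Side → ℕ ⊎ ℕ → Set
OnSide s u = u ≡ embed s (reduce u)

side-of : ∀ u → Σ Side λ s → OnSide s u
side-of (inj₁ _) = primes , refl
side-of (inj₂ _) = numbers , refl

embed-injective : ∀ s {a b} → embed s a ≡ embed s b → a ≡ b
embed-injective primes  = inj₁-injective
embed-injective numbers = inj₂-injective

embed-opp-disjoint : ∀ s {a b} → embed s a ≢ embed (opp s) b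
embed-opp-disjoint primes  ()
embed-opp-disjoint numbers ()

OnSide-injective : ∀ s {u w} → OnSide s u → OnSide s w → reduce u ≡ reduce w → u ≡ w
OnSide-injective s u-on w-on e = trans u-on (trans (cong (embed s) e) (sym w-on))

BAdj-sym : ∀ u w → BAdj u w → BAdj w u
BAdj-sym (inj₁ _) (inj₂ _) a = a
BAdj-sym (inj₂ _) (inj₁ _) a = a

BAdj⇒opp : ∀ s {u w} → OnSide s u → BAdj u w → OnSide (opp s) w
BAdj⇒opp primes  {inj₁ _} {inj₂ _} _ _ = refl
BAdj⇒opp numbers {inj₂ _} {inj₁ _} _ _ = refl

common-neighbour⇒same-side : ∀ s {u w v} → OnSide s u → BAdj u w → BAdj w v → OnSide s v
common-neighbour⇒same-side primes  {inj₁ _} {inj₂ _} {inj₁ _} _ _ _ = refl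
common-neighbour⇒same-side numbers {inj₂ _} {inj₁ _} {inj₂ _} _ _ _ = refl

record IncCopy (X : NatSet) (s : Side) (ℓ : ℕ) : Set where
  field
    vertex           : Fin ℓ → ℕ
    edge             : (i j : Fin ℓ) → i Fin.< j → ℕ
    vertex-in-B      : ∀ i → BVert X (embed s (vertex i))
    edge-in-B        : ∀ i j h → BVert X (embed (opp s) (edge i j h))
    vertex-injective : ∀ i j → vertex i ≡ vertex j → i ≡ j
    edge-injective   : PairInjective edge
    incident-fst     : ∀ i j h → BAdj (embed s (vertex i)) (embed (opp s) (edge i j h))
    incident-snd     : ∀ i j h → BAdj (embed s (vertex j)) (embed (opp s) (edge i j h))

  incident : ∀ v i j h → v ≡ i ⊎ v ≡ j → BAdj (embed s (vertex v)) (embed (opp s) (edge i j h))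
  incident v i j h (inj₁ refl) = incident-fst i j h
  incident v i j h (inj₂ refl) = incident-snd i j h

open IncCopy

copy⇒IncCopy : ∀ {X ℓ} → 1 ≤ ℓ → ContainsCopyOf (B X) (IncK ℓ) → Σ Side λ s → IncCopy X s ℓ
copy⇒IncCopy {X} {suc m} _ (f , f-vert , f-inj , f-adj) = s , record
  { vertex           = λ i → reduce (f (inj₁ i))
  ; edge             = λ i j _ → reduce (f (inj₂ (i , j)))
  ; vertex-in-B      = λ i → subst (BVert X) (vertex-on-side i) (f-vert (inj₁ i) tt)
  ; edge-in-B        = λ i j h → subst (BVert X) (edge-on-side i j h) (f-vert (inj₂ (i , j)) h)
  ; vertex-injective = λ i j e →
      inj₁-injective (f-inj (inj₁ i) (inj₁ j) tt tt
        (OnSide-injective s (vertex-on-side i) (vertex-on-side j) e))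
  ; edge-injective   = λ i j k l h h' e →
      let ij≡kl = inj₂-injective (f-inj (inj₂ (i , j)) (inj₂ (k , l)) h h'
                    (OnSide-injective (opp s) (edge-on-side i j h) (edge-on-side k l h') e))
      in ,-injectiveˡ ij≡kl , ,-injectiveʳ ij≡kl
  ; incident-fst     = λ i j h →
      subst₂ BAdj (vertex-on-side i) (edge-on-side i j h) (f-adj-edge i i j h (inj₁ refl))
  ; incident-snd     = λ i j h →
      subst₂ BAdj (vertex-on-side j) (edge-on-side i j h) (f-adj-edge j i j h (inj₂ refl))
  }
  where
  s : Side
  s = proj₁ (side-of (f (inj₁ Fin.zero)))

  f-adj-edge : ∀ v i j → i Fin.< j → v ≡ i ⊎ v ≡ j → BAdj (f (inj₁ v)) (f (inj₂ (i , j)))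
  f-adj-edge v i j h v∈ij = f-adj (inj₁ v) (inj₂ (i , j)) tt h v∈ij

  -- vertex i shares the neighbour {0,i} with vertex 0
  vertex-on-side : ∀ i → OnSide s (f (inj₁ i))
  vertex-on-side Fin.zero    = proj₂ (side-of (f (inj₁ Fin.zero)))
  vertex-on-side (Fin.suc k) = common-neighbour⇒same-side s (vertex-on-side Fin.zero)
    (f-adj-edge Fin.zero Fin.zero (Fin.suc k) z<s (inj₁ refl))
    (BAdj-sym _ _ (f-adj-edge (Fin.suc k) Fin.zero (Fin.suc k) z<s (inj₂ refl)))

  edge-on-side : ∀ i j → i Fin.< j → OnSide (opp s) (f (inj₂ (i , j)))
  edge-on-side i j h = BAdj⇒opp s (vertex-on-side i) (f-adj-edge i i j h (inj₁ refl))

module _ {X : NatSet} {s : Side} {ℓ : ℕ} (c : IncCopy X s ℓ) where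

  -- the edge labels extended by an arbitrary value to pairs that are not edges
  edge-total : Fin ℓ → Fin ℓ → ℕ
  edge-total i j with i <? j
  ... | yes h = edge c i j h
  ... | no _  = 0

  edge-total-≡ : ∀ {i j} (h : i Fin.< j) → edge-total i j ≡ edge c i j h
  edge-total-≡ {i} {j} h with i <? j
  ... | yes h' = cong (edge c i j) (<-irrelevant h' h)
  ... | no ¬h  = ⊥-elim (¬h h)

  IncCopy⇒copy : ContainsCopyOf (B X) (IncK ℓ)
  IncCopy⇒copy = g , g-vert , g-inj , g-adj
    where
    g : V (IncK ℓ) → V (B X)
    g (inj₁ v)       = embed s (vertex c v)
    g (inj₂ (i , j)) = embed (opp s) (edge-total i j)

    g-vert : ∀ u → Vert (IncK ℓ) u → Vert (B X) (g u)
    g-vert (inj₁ v)       _ = vertex-in-B c v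
    g-vert (inj₂ (i , j)) h =
      subst (λ e → BVert X (embed (opp s) e)) (sym (edge-total-≡ h)) (edge-in-B c i j h)

    g-inj : ∀ u w → Vert (IncK ℓ) u → Vert (IncK ℓ) w → g u ≡ g w → u ≡ w
    g-inj (inj₁ a)       (inj₁ b)       _ _  e = cong inj₁ (vertex-injective c a b (embed-injective s e))
    g-inj (inj₁ _)       (inj₂ _)       _ _  e = ⊥-elim (embed-opp-disjoint s e)
    g-inj (inj₂ _)       (inj₁ _)       _ _  e = ⊥-elim (embed-opp-disjoint s (sym e))
    g-inj (inj₂ (i , j)) (inj₂ (k , l)) h h' e =
      let i≡k , j≡l = edge-injective c i j k l h h'
                        (trans (sym (edge-total-≡ h))
                          (trans (embed-injective (opp s) e) (edge-total-≡ h')))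
      in cong inj₂ (cong₂ _,_ i≡k j≡l)

    g-adj-edge : ∀ v i j → i Fin.< j → v ≡ i ⊎ v ≡ j → BAdj (g (inj₁ v)) (g (inj₂ (i , j)))
    g-adj-edge v i j h v∈ij =
      subst (λ e → BAdj (embed s (vertex c v)) (embed (opp s) e)) (sym (edge-total-≡ h))
        (incident c v i j h v∈ij)

    g-adj : ∀ u w → Vert (IncK ℓ) u → Vert (IncK ℓ) w → Adj (IncK ℓ) u w → Adj (B X) (g u) (g w)
    g-adj (inj₁ v)       (inj₂ (i , j)) _ h v∈ij = g-adj-edge v i j h v∈ij
    g-adj (inj₂ (i , j)) (inj₁ v)       h _ v∈ij = BAdj-sym _ _ (g-adj-edge v i j h v∈ij)

CondI⇒IncCopy : ∀ {X ℓ} → CondI X ℓ → IncCopy X numbers ℓ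
CondI⇒IncCopy (x , xX* , x-inj , _ , p , p-inj , p-prop) = record
  { vertex           = x
  ; edge             = p
  ; vertex-in-B      = xX*
  ; edge-in-B        = λ i j h → proj₁ (p-prop i j h) , x i , proj₁ (xX* i) , p∣x-fst i j h
  ; vertex-injective = x-inj
  ; edge-injective   = p-inj
  ; incident-fst     = p∣x-fst
  ; incident-snd     = λ i j h → ∣-trans (proj₂ (p-prop i j h)) (gcd[m,n]∣n (x i) (x j))
  }
  where
  p∣x-fst : ∀ i j h → p i j h ∣ x i
  p∣x-fst i j h = ∣-trans (proj₂ (p-prop i j h)) (gcd[m,n]∣m (x i) (x j))

IncCopy⇒CondI : ∀ {X ℓ} → (∀ x → X x → 0 < x) → IncCopy X numbers ℓ → CondI X ℓ
IncCopy⇒CondI {X} pos c =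
  vertex c , vertex-in-B c , vertex-injective c ,
  ordered⇒distinct ΓAdj-sym Γ-ordered ,
  edge c , edge-injective c , λ i j h → proj₁ (edge-in-B c i j h) , edge∣gcd i j h
  where
  edge∣gcd : ∀ i j h → edge c i j h ∣ gcd (vertex c i) (vertex c j)
  edge∣gcd i j h = gcd-greatest (incident-fst c i j h) (incident-snd c i j h)

  vertex≢0 : ∀ i → vertex c i ≢ 0
  vertex≢0 i = >⇒≢ (pos _ (proj₁ (vertex-in-B c i)))

  Γ-ordered : ∀ i j → i Fin.< j → ΓAdj (vertex c i) (vertex c j)
  Γ-ordered i j h =
    (λ e → <⇒≢ h (vertex-injective c i j e)) ,
    prime∣⇒1< (gcd[m,n]≢0 _ _ (inj₁ (vertex≢0 i))) (proj₁ (edge-in-B c i j h)) (edge∣gcd i j h)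

CondII⇒IncCopy : ∀ {X ℓ} → CondII X ℓ → IncCopy X primes ℓ
CondII⇒IncCopy (p , pρ , p-inj , _ , x , x-inj , x-prop) = record
  { vertex           = p
  ; edge             = x
  ; vertex-in-B      = pρ
  ; edge-in-B        = λ i j h → proj₁ (x-prop i j h)
  ; vertex-injective = p-inj
  ; edge-injective   = x-inj
  ; incident-fst     = λ i j h → ∣-trans (m∣m*n (p j)) (proj₂ (x-prop i j h))
  ; incident-snd     = λ i j h → ∣-trans (n∣m*n (p i)) (proj₂ (x-prop i j h))
  }

IncCopy⇒CondII : ∀ {X ℓ} → IncCopy X primes ℓ → CondII X ℓ
IncCopy⇒CondII {X} c =
  vertex c , vertex-in-B c , vertex-injective c ,
  ordered⇒distinct (ΔAdj-sym X) Δ-ordered ,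
  edge c , edge-injective c , λ i j h → edge-in-B c i j h , product∣edge i j h
  where
  vertex-distinct : ∀ i j → i Fin.< j → vertex c i ≢ vertex c j
  vertex-distinct i j h e = <⇒≢ h (vertex-injective c i j e)

  product∣edge : ∀ i j h → vertex c i * vertex c j ∣ edge c i j h
  product∣edge i j h =
    distinct-primes⇒*∣ (proj₁ (vertex-in-B c i)) (proj₁ (vertex-in-B c j)) (vertex-distinct i j h)
      (incident-fst c i j h) (incident-snd c i j h)

  Δ-ordered : ∀ i j → i Fin.< j → ΔAdj X (vertex c i) (vertex c j)
  Δ-ordered i j h =
    vertex-distinct i j h , edge c i j h , proj₁ (edge-in-B c i j h) , product∣edge i j h

lemma4p5 : (X : NatSet) → (∀ x → X x → 0 < x) → (∃[ x ] X x) → ¬ (∀ x → X x ⇔ x ≡ 1)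
    → (ℓ : ℕ) → 1 ≤ ℓ
    → ContainsCopyOf (B X) (IncK ℓ) ⇔ (CondI X ℓ ⊎ CondII X ℓ)
lemma4p5 X pos _ _ ℓ 1≤ℓ = mk⇔ to from
  where
  to : ContainsCopyOf (B X) (IncK ℓ) → CondI X ℓ ⊎ CondII X ℓ
  to copy with copy⇒IncCopy 1≤ℓ copy
  ... | numbers , c = inj₁ (IncCopy⇒CondI pos c)
  ... | primes  , c = inj₂ (IncCopy⇒CondII c)

  from : CondI X ℓ ⊎ CondII X ℓ → ContainsCopyOf (B X) (IncK ℓ)
  from (inj₁ cond) = IncCopy⇒copy (CondI⇒IncCopy cond)
  from (inj₂ cond) = IncCopy⇒copy (CondII⇒IncCopy cond)
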